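{- If $S$ is a closed $\forall^+$ type of System $\mathcal F$, then $S$ is an output type.
   Context: System $\mathcal F$: types are built from type variables (and type constants) with $\rightarrow$ and $\forall$; only types in which every quantified variable actually occurs in its scope are considered. Terms are pure $\lambda$-terms; $Fv(t)$ denotes free variables. Typing $\Gamma\vdash_{\mathcal F} t:A$ is given by (ax), ($\rightarrow_i$): from $\Gamma,x:B\vdash t:C$ infer $\Gamma\vdash\lambda xt:B\rightarrow C$, ($\rightarrow_e$): from $\Gamma\vdash u:B\rightarrow C$, $\Gamma\vdash v:B$ infer $\Gamma\vdash(u)v:C$, ($\forall_i$): from $\Gamma\vdash t:A$ with $X$ not free in $\Gamma$ infer $\Gamma\vdash t:\forall XA$, ($\forall_e$): from $\Gamma\vdash t:\forall XA$ infer $\Gamma\vdash t:A[C/X]$. A closed type $S$ is an output type iff for every $\beta$-normal $\lambda$-term $t$, if $\vdash_{\mathcal F}\lambda xt:\forall X(X\rightarrow S)$ then $x\notin Fv(t)$. $\forall^+$/$\forall^-$ types: a type variable is both; if $A$ is $\forall^+$ (resp. $\forall^-$) and $B$ is $\forall^-$ (resp. $\forall^+$) then $B\rightarrow A$ is $\forall^+$ (resp. $\forall^-$); if $A$ is $\forall^+$ and $X$ is free in $A$ then $\forall XA$ is $\forall^+$. -}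

module Defs where

open import Data.Nat using (ℕ; zero; suc)
open import Data.List using (List; []; _∷_; map)
open import Data.Sum using (_⊎_)
open import Data.Empty using (⊥)
open import Relation.Nullary using (¬_)
open import Data.Unit using (⊤)
open import Data.Product using (_×_)

infixr 7 _⇒_

data Ty : Set where
  tvar : ℕ → Ty
  tcon : ℕ → Ty
  _⇒_  : Ty → Ty → Ty
  ∀'   : Ty → Ty         -- ∀ binds index 0 in its body

ext : (ℕ → ℕ) → ℕ → ℕ
ext ρ zero    = zero
ext ρ (suc n) = suc (ρ n)

ren : (ℕ → ℕ) → Ty → Ty
ren ρ (tvar n) = tvar (ρ n)
ren ρ (tcon c) = tcon c
ren ρ (A ⇒ B)  = ren ρ A ⇒ ren ρ B
ren ρ (∀' A)   = ∀' (ren (ext ρ) A)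

weaken : Ty → Ty
weaken = ren suc

exts : (ℕ → Ty) → ℕ → Ty
exts σ zero    = tvar zero
exts σ (suc n) = weaken (σ n)

sub : (ℕ → Ty) → Ty → Ty
sub σ (tvar n) = σ n
sub σ (tcon c) = tcon c
sub σ (A ⇒ B)  = sub σ A ⇒ sub σ B
sub σ (∀' A)   = ∀' (sub (exts σ) A)

single : Ty → ℕ → Ty
single C zero    = C
single C (suc n) = tvar n

_[_] : Ty → Ty → Ty
A [ C ] = sub (single C) A

data TFree : ℕ → Ty → Set where
  tv   : ∀ {n} → TFree n (tvar n)
  ⇒ˡ   : ∀ {n A B} → TFree n A → TFree n (A ⇒ B)
  ⇒ʳ   : ∀ {n A B} → TFree n B → TFree n (A ⇒ B)
  under : ∀ {n A} → TFree (suc n) A → TFree n (∀' A)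

Closed : Ty → Set
Closed A = ∀ n → ¬ TFree n A

data Good : Ty → Set where
  gvar : ∀ {n} → Good (tvar n)
  gcon : ∀ {c} → Good (tcon c)
  g⇒   : ∀ {A B} → Good A → Good B → Good (A ⇒ B)
  g∀   : ∀ {A} → Good A → TFree zero A → Good (∀' A)

mutual
  data Pos : Ty → Set where
    pvar : ∀ {n} → Pos (tvar n)
    p⇒   : ∀ {A B} → Neg B → Pos A → Pos (B ⇒ A)
    p∀   : ∀ {A} → Pos A → TFree zero A → Pos (∀' A)

  data Neg : Ty → Set where
    nvar : ∀ {n} → Neg (tvar n)
    n⇒   : ∀ {A B} → Pos B → Neg A → Neg (B ⇒ A)

data Term : Set where
  var : ℕ → Term
  lam : Term → Term
  app : Term → Term → Term

data Free : ℕ → Term → Set where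
  fvar : ∀ {n} → Free n (var n)
  flam : ∀ {n t} → Free (suc n) t → Free n (lam t)
  fapˡ : ∀ {n u v} → Free n u → Free n (app u v)
  fapʳ : ∀ {n u v} → Free n v → Free n (app u v)

IsLam : Term → Set
IsLam (lam _) = ⊤
IsLam _       = ⊥

data Normal : Term → Set where
  nvar : ∀ {n} → Normal (var n)
  nlam : ∀ {t} → Normal t → Normal (lam t)
  napp : ∀ {u v} → ¬ IsLam u → Normal u → Normal v → Normal (app u v)

Ctx : Set
Ctx = List Ty

data _∋_∶_ : Ctx → ℕ → Ty → Set where
  here  : ∀ {Γ A} → (A ∷ Γ) ∋ zero ∶ A
  there : ∀ {Γ A B n} → Γ ∋ n ∶ A → (B ∷ Γ) ∋ suc n ∶ A

infix 4 _⊢_∶_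
data _⊢_∶_ : Ctx → Term → Ty → Set where
  ax  : ∀ {Γ x A} → Γ ∋ x ∶ A → Γ ⊢ var x ∶ A
  →i  : ∀ {Γ t B C} → Good B → (B ∷ Γ) ⊢ t ∶ C → Γ ⊢ lam t ∶ B ⇒ C
  →e  : ∀ {Γ u v B C} → Γ ⊢ u ∶ B ⇒ C → Γ ⊢ v ∶ B → Γ ⊢ app u v ∶ C
  -- X (index 0) not free in Γ: Γ is shifted past the new binder
  ∀i  : ∀ {Γ t A} → map weaken Γ ⊢ t ∶ A → TFree zero A → Γ ⊢ t ∶ ∀' A
  ∀e  : ∀ {Γ t A} (C : Ty) → Good C → Γ ⊢ t ∶ ∀' A → Γ ⊢ t ∶ A [ C ]

OutputType : Ty → Set
OutputType S =
  Closed S × ((t : Term) → Normal t → [] ⊢ lam t ∶ ∀' (tvar zero ⇒ weaken S) → ¬ Free zero t)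

module Submission where

-- Inverting the typing of the λ gives  x : X ⊢ t : S.  We track how a free
-- occurrence of a variable x : X_k can surface in a normal term u : A:
--   * either A "carries" X_k (relation 'Carries': X_k is reached by going
--     to codomains and ∀-bodies, or through the argument of an argument),
--   * or some other variable of the context has a type that "absorbs" X_k
--     (relation 'Absorbs': an instance of that type takes an argument
--     carrying X_k).
-- This occurrence lemma is proved by mutual induction with an analysis of
-- neutral terms (a head variable applied to a spine).  In the context
-- x : X there is no other variable, so S would carry X; but a ∀⁺ type in
-- which X is not free never carries X (and a ∀⁻ type never absorbs it),
-- which is the polarity lemma.

open import Defs
open import Data.Nat using (ℕ; zero; suc)
open import Data.Nat.Properties using (_≟_)
open import Data.List using ([]; _∷_; map)
open import Data.Product using (Σ; _×_; _,_)
open import Data.Sum using (_⊎_; inj₁; inj₂)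
open import Data.Empty using (⊥; ⊥-elim)
open import Data.Unit using (tt)
open import Function using (case_of_)
open import Relation.Nullary using (¬_; yes; no)
open import Relation.Binary.PropositionalEquality
  using (_≡_; _≢_; refl; sym; trans; cong; cong₂; subst)

ext-cong : ∀ {ρ ρ′} → (∀ n → ρ n ≡ ρ′ n) → ∀ n → ext ρ n ≡ ext ρ′ n
ext-cong h zero    = refl
ext-cong h (suc n) = cong suc (h n)

ren-cong : ∀ {ρ ρ′} → (∀ n → ρ n ≡ ρ′ n) → ∀ A → ren ρ A ≡ ren ρ′ A
ren-cong h (tvar n) = cong tvar (h n)
ren-cong h (tcon c) = refl
ren-cong h (A ⇒ B)  = cong₂ _⇒_ (ren-cong h A) (ren-cong h B)
ren-cong h (∀' A)   = cong ∀' (ren-cong (ext-cong h) A)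

exts-cong : ∀ {σ τ} → (∀ n → σ n ≡ τ n) → ∀ n → exts σ n ≡ exts τ n
exts-cong h zero    = refl
exts-cong h (suc n) = cong weaken (h n)

sub-cong : ∀ {σ τ} → (∀ n → σ n ≡ τ n) → ∀ A → sub σ A ≡ sub τ A
sub-cong h (tvar n) = h n
sub-cong h (tcon c) = refl
sub-cong h (A ⇒ B)  = cong₂ _⇒_ (sub-cong h A) (sub-cong h B)
sub-cong h (∀' A)   = cong ∀' (sub-cong (exts-cong h) A)

ren-ren : ∀ ρ ρ′ A → ren ρ (ren ρ′ A) ≡ ren (λ n → ρ (ρ′ n)) A
ren-ren ρ ρ′ (tvar n) = refl
ren-ren ρ ρ′ (tcon c) = refl
ren-ren ρ ρ′ (A ⇒ B)  = cong₂ _⇒_ (ren-ren ρ ρ′ A) (ren-ren ρ ρ′ B)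
ren-ren ρ ρ′ (∀' A)   = cong ∀' (trans (ren-ren (ext ρ) (ext ρ′) A)
  (ren-cong (λ { zero → refl ; (suc n) → refl }) A))

sub-ren : ∀ σ ρ A → sub σ (ren ρ A) ≡ sub (λ n → σ (ρ n)) A
sub-ren σ ρ (tvar n) = refl
sub-ren σ ρ (tcon c) = refl
sub-ren σ ρ (A ⇒ B)  = cong₂ _⇒_ (sub-ren σ ρ A) (sub-ren σ ρ B)
sub-ren σ ρ (∀' A)   = cong ∀' (trans (sub-ren (exts σ) (ext ρ) A)
  (sub-cong (λ { zero → refl ; (suc n) → refl }) A))

ren-sub : ∀ ρ σ A → ren ρ (sub σ A) ≡ sub (λ n → ren ρ (σ n)) A
ren-sub ρ σ (tvar n) = refl
ren-sub ρ σ (tcon c) = refl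
ren-sub ρ σ (A ⇒ B)  = cong₂ _⇒_ (ren-sub ρ σ A) (ren-sub ρ σ B)
ren-sub ρ σ (∀' A)   = cong ∀' (trans (ren-sub (ext ρ) (exts σ) A) (sub-cong lift A))
  where
  lift : ∀ n → ren (ext ρ) (exts σ n) ≡ exts (λ m → ren ρ (σ m)) n
  lift zero    = refl
  lift (suc n) = trans (ren-ren (ext ρ) suc (σ n)) (sym (ren-ren suc ρ (σ n)))

sub-exts-weaken : ∀ σ A → sub (exts σ) (weaken A) ≡ weaken (sub σ A)
sub-exts-weaken σ A = trans (sub-ren (exts σ) suc A) (sym (ren-sub suc σ A))

sub-sub : ∀ τ σ A → sub τ (sub σ A) ≡ sub (λ n → sub τ (σ n)) A
sub-sub τ σ (tvar n) = refl
sub-sub τ σ (tcon c) = refl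
sub-sub τ σ (A ⇒ B)  = cong₂ _⇒_ (sub-sub τ σ A) (sub-sub τ σ B)
sub-sub τ σ (∀' A)   = cong ∀' (trans (sub-sub (exts τ) (exts σ) A) (sub-cong lift A))
  where
  lift : ∀ n → sub (exts τ) (exts σ n) ≡ exts (λ m → sub τ (σ m)) n
  lift zero    = refl
  lift (suc n) = sub-exts-weaken τ (σ n)

sub-id : ∀ A → sub tvar A ≡ A
sub-id (tvar n) = refl
sub-id (tcon c) = refl
sub-id (A ⇒ B)  = cong₂ _⇒_ (sub-id A) (sub-id B)
sub-id (∀' A)   = cong ∀' (trans (sub-cong (λ { zero → refl ; (suc n) → refl }) A) (sub-id A))

inst-weaken : ∀ C A → sub (single C) (weaken A) ≡ A
inst-weaken C A = trans (sub-ren (single C) suc A) (sub-id A)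

sub-inst : ∀ σ C A → sub σ (A [ C ]) ≡ (sub (exts σ) A) [ sub σ C ]
sub-inst σ C A = trans (sub-sub σ (single C) A)
  (trans (sub-cong pointwise A) (sym (sub-sub (single (sub σ C)) (exts σ) A)))
  where
  pointwise : ∀ n → sub σ (single C n) ≡ sub (single (sub σ C)) (exts σ n)
  pointwise zero    = refl
  pointwise (suc n) = sym (inst-weaken (sub σ C) (σ n))

TFree-ren : ∀ {ρ j A} → TFree j A → TFree (ρ j) (ren ρ A)
TFree-ren tv        = tv
TFree-ren (⇒ˡ t)    = ⇒ˡ (TFree-ren t)
TFree-ren (⇒ʳ t)    = ⇒ʳ (TFree-ren t)
TFree-ren (under t) = under (TFree-ren t)

TFree-sub : ∀ {σ j j′ A} → TFree j A → TFree j′ (σ j) → TFree j′ (sub σ A)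
TFree-sub tv        s = s
TFree-sub (⇒ˡ t)    s = ⇒ˡ (TFree-sub t s)
TFree-sub (⇒ʳ t)    s = ⇒ʳ (TFree-sub t s)
TFree-sub (under t) s = under (TFree-sub t (TFree-ren s))

Good-ren : ∀ {ρ A} → Good A → Good (ren ρ A)
Good-ren gvar     = gvar
Good-ren gcon     = gcon
Good-ren (g⇒ a b) = g⇒ (Good-ren a) (Good-ren b)
Good-ren (g∀ a t) = g∀ (Good-ren a) (TFree-ren t)

Good-exts : ∀ {σ} → (∀ n → Good (σ n)) → ∀ n → Good (exts σ n)
Good-exts h zero    = gvar
Good-exts h (suc n) = Good-ren (h n)

Good-single : ∀ {C} → Good C → ∀ n → Good (single C n)
Good-single g zero    = g
Good-single g (suc n) = gvar

Good-sub : ∀ {σ A} → (∀ n → Good (σ n)) → Good A → Good (sub σ A)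
Good-sub h (gvar {n}) = h n
Good-sub h gcon       = gcon
Good-sub h (g⇒ a b)   = g⇒ (Good-sub h a) (Good-sub h b)
Good-sub h (g∀ a t)   = g∀ (Good-sub (Good-exts h) a) (TFree-sub t tv)

∋-map : ∀ {f : Ty → Ty} {Γ m A} → Γ ∋ m ∶ A → map f Γ ∋ m ∶ f A
∋-map here      = here
∋-map (there l) = there (∋-map l)

∋-map⁻ : ∀ {f : Ty → Ty} {Γ m A′} → map f Γ ∋ m ∶ A′ → Σ Ty λ A → (Γ ∋ m ∶ A) × (A′ ≡ f A)
∋-map⁻ {Γ = []}    ()
∋-map⁻ {Γ = B ∷ Γ} here = B , here , refl
∋-map⁻ {Γ = B ∷ Γ} (there l) with ∋-map⁻ l
... | A , l′ , e = A , there l′ , e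

∋-det : ∀ {Γ m A B} → Γ ∋ m ∶ A → Γ ∋ m ∶ B → A ≡ B
∋-det here      here       = refl
∋-det (there l) (there l′) = ∋-det l l′

map-sub-weaken : ∀ σ Γ → map (sub (exts σ)) (map weaken Γ) ≡ map weaken (map (sub σ) Γ)
map-sub-weaken σ []      = refl
map-sub-weaken σ (A ∷ Γ) = cong₂ _∷_ (sub-exts-weaken σ A) (map-sub-weaken σ Γ)

map-inst-weaken : ∀ C Γ → map (sub (single C)) (map weaken Γ) ≡ Γ
map-inst-weaken C []      = refl
map-inst-weaken C (A ∷ Γ) = cong₂ _∷_ (inst-weaken C A) (map-inst-weaken C Γ)

⊢-sub : ∀ {Γ t A} σ → (∀ n → Good (σ n)) → Γ ⊢ t ∶ A → map (sub σ) Γ ⊢ t ∶ sub σ A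
⊢-sub σ h (ax l)   = ax (∋-map l)
⊢-sub σ h (→i g d) = →i (Good-sub h g) (⊢-sub σ h d)
⊢-sub σ h (→e d e) = →e (⊢-sub σ h d) (⊢-sub σ h e)
⊢-sub {Γ} {t} σ h (∀i {A = A} d X-free) =
  ∀i (subst (λ Δ → Δ ⊢ t ∶ sub (exts σ) A) (map-sub-weaken σ Γ) (⊢-sub (exts σ) (Good-exts h) d))
     (TFree-sub X-free tv)
⊢-sub {Γ} {t} σ h (∀e {A = A} C g d) =
  subst (λ T → map (sub σ) Γ ⊢ t ∶ T) (sym (sub-inst σ C A))
    (∀e (sub σ C) (Good-sub h g) (⊢-sub σ h d))

-- What a derivation of Γ ⊢ λ t : T yields for the body: strip the ∀s of T
-- (weakening Γ) and type t against the arrow underneath.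
LamBody : Ctx → Term → Ty → Set
LamBody Γ t (B ⇒ C)  = (B ∷ Γ) ⊢ t ∶ C
LamBody Γ t (∀' A)   = LamBody (map weaken Γ) t A
LamBody Γ t (tvar _) = ⊥
LamBody Γ t (tcon _) = ⊥

LamBody-sub : ∀ {t} σ → (∀ n → Good (σ n)) → ∀ Δ A → LamBody Δ t A → LamBody (map (sub σ) Δ) t (sub σ A)
LamBody-sub σ h Δ (B ⇒ C) d = ⊢-sub σ h d
LamBody-sub {t} σ h Δ (∀' A) b =
  subst (λ Γ → LamBody Γ t (sub (exts σ) A)) (map-sub-weaken σ Δ)
    (LamBody-sub (exts σ) (Good-exts h) (map weaken Δ) A b)

-- Inversion of λ: eliminations of ∀ are pushed into the body by ⊢-sub.
lam-inversion : ∀ {Γ t T} → Γ ⊢ lam t ∶ T → LamBody Γ t T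
lam-inversion (→i g d)  = d
lam-inversion (∀i d _)  = lam-inversion d
lam-inversion {Γ} {t} (∀e {A = A} C g d) =
  subst (λ Δ → LamBody Δ t (A [ C ])) (map-inst-weaken C Γ)
    (LamBody-sub (single C) (Good-single g) (map weaken Γ) A (lam-inversion d))

-- Carries k A: a normal term of type A may contain a free variable of type
-- X_k that is not swallowed as the argument of another variable.  Absorbs k U: a head variable of type
-- U can be applied (after instantiations) to an argument that carries X_k.
mutual
  data Carries : ℕ → Ty → Set where
    c-var : ∀ {k} → Carries k (tvar k)
    c-cod : ∀ {k B C} → Carries k C → Carries k (B ⇒ C)
    c-dom : ∀ {k B C} → Absorbs k B → Carries k (B ⇒ C)
    c-all : ∀ {k A} → Carries (suc k) A → Carries k (∀' A)

  data Absorbs : ℕ → Ty → Set where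
    a-arg  : ∀ {k B C} → Carries k B → Absorbs k (B ⇒ C)
    a-cod  : ∀ {k B C} → Absorbs k C → Absorbs k (B ⇒ C)
    a-inst : ∀ {k A} C → Absorbs k (A [ C ]) → Absorbs k (∀' A)

mutual
  Carries-sub : ∀ {j j′ A} σ → σ j ≡ tvar j′ → Carries j A → Carries j′ (sub σ A)
  Carries-sub σ e c-var     = subst (Carries _) (sym e) c-var
  Carries-sub σ e (c-cod c) = c-cod (Carries-sub σ e c)
  Carries-sub σ e (c-dom a) = c-dom (Absorbs-sub σ e a)
  Carries-sub σ e (c-all c) = c-all (Carries-sub (exts σ) (cong weaken e) c)

  Absorbs-sub : ∀ {j j′ A} σ → σ j ≡ tvar j′ → Absorbs j A → Absorbs j′ (sub σ A)
  Absorbs-sub σ e (a-arg c) = a-arg (Carries-sub σ e c)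
  Absorbs-sub σ e (a-cod a) = a-cod (Absorbs-sub σ e a)
  Absorbs-sub σ e (a-inst {A = A} C a) =
    a-inst (sub σ C) (subst (Absorbs _) (sub-inst σ C A) (Absorbs-sub σ e a))

Carries-inst : ∀ {k A} C → Carries k (∀' A) → Carries k (A [ C ])
Carries-inst C (c-all c) = Carries-sub (single C) refl c

-- Polarity lemma: a ∀⁺ type not mentioning X_k does not carry it, and a ∀⁻
-- type does not absorb it (∀⁻ types have no ∀, so no instantiation helps).
mutual
  pos-not-carries : ∀ {k A} → Pos A → ¬ TFree k A → ¬ Carries k A
  pos-not-carries pvar        fresh c-var     = fresh tv
  pos-not-carries (p⇒ nb pa)  fresh (c-cod c) = pos-not-carries pa (λ t → fresh (⇒ʳ t)) c
  pos-not-carries (p⇒ nb pa)  fresh (c-dom a) = neg-not-absorbs nb (λ t → fresh (⇒ˡ t)) a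
  pos-not-carries (p∀ pa _)   fresh (c-all c) = pos-not-carries pa (λ t → fresh (under t)) c

  neg-not-absorbs : ∀ {k A} → Neg A → ¬ TFree k A → ¬ Absorbs k A
  neg-not-absorbs nvar       fresh ()
  neg-not-absorbs (n⇒ pb na) fresh (a-arg c) = pos-not-carries pb (λ t → fresh (⇒ˡ t)) c
  neg-not-absorbs (n⇒ pb na) fresh (a-cod a) = neg-not-absorbs na (λ t → fresh (⇒ʳ t)) a

data Absorber (k n : ℕ) (Γ : Ctx) : Set where
  absorber : ∀ {m U} → m ≢ n → Γ ∋ m ∶ U → Absorbs k U → Absorber k n Γ

Absorber-pop : ∀ {k n B Γ} → Absorber k (suc n) (B ∷ Γ) → Absorbs k B ⊎ Absorber k n Γ
Absorber-pop (absorber _  here      a) = inj₁ a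
Absorber-pop (absorber ne (there l) a) = inj₂ (absorber (λ e → ne (cong suc e)) l a)

-- Leaving the scope of a ∀ introduction: instantiate the new X₀ by X₀,
-- which turns the weakened absorbing type back into the original one.
Absorber-unweaken : ∀ {k n Γ} → Absorber (suc k) n (map weaken Γ) → Absorber k n Γ
Absorber-unweaken {k} (absorber ne l a) with ∋-map⁻ l
... | U , l′ , refl =
  absorber ne l′ (subst (Absorbs k) (inst-weaken (tvar 0) U) (Absorbs-sub (single (tvar 0)) refl a))

-- T ⊑ U: T is the type of a head of type U after applications and type
-- instantiations, so every instance of T absorbs only what U absorbs.
record _⊑_ (T U : Ty) : Set where
  constructor residual
  field transport : ∀ σ j → Absorbs j (sub σ T) → Absorbs j (sub σ U)
open _⊑_

⊑-refl : ∀ {T} → T ⊑ T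
⊑-refl = residual λ σ j a → a

⊑-app : ∀ {B T U} → (B ⇒ T) ⊑ U → T ⊑ U
⊑-app r = residual λ σ j a → transport r σ j (a-cod a)

⊑-inst : ∀ {U} A C → ∀' A ⊑ U → (A [ C ]) ⊑ U
⊑-inst A C r = residual λ σ j a →
  transport r σ j (a-inst (sub σ C) (subst (Absorbs j) (sub-inst σ C A) a))

⊑-gen : ∀ {A U} → A ⊑ weaken U → ∀' A ⊑ U
⊑-gen {A} {U} r = residual instantiated
  where
  instantiated : ∀ σ j → Absorbs j (sub σ (∀' A)) → Absorbs j (sub σ U)
  instantiated σ j (a-inst C a) =
    subst (Absorbs j) (trans (sub-ren τ suc U) (sub-cong (λ m → inst-weaken C (σ m)) U))
      (transport r τ j (subst (Absorbs j) (sub-sub (single C) (exts σ) A) a))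
    where
    τ : ℕ → Ty
    τ m = sub (single C) (exts σ m)

-- Read off the identity substitution: T ⊑ U transports absorptions of T to U.
⊑-absorbs : ∀ {j T U} → T ⊑ U → Absorbs j T → Absorbs j U
⊑-absorbs {j} {T} {U} r a =
  subst (Absorbs j) (sub-id U) (transport r tvar j (subst (Absorbs j) (sym (sub-id T)) a))

absorb-argument : ∀ {k n Γ h U B T} → h ≢ n → Γ ∋ h ∶ U → (B ⇒ T) ⊑ U →
                  Carries k B ⊎ Absorber k n Γ → Absorber k n Γ
absorb-argument ne l r (inj₁ c) = absorber ne l (⊑-absorbs r (a-arg c))
absorb-argument ne l r (inj₂ a) = a

-- Shape of a normal non-λ term f : T with respect to a variable x = n : X_k:
-- it is x itself, or its head h is another variable, T is a residual of h's
-- type, and any occurrence of x in f is absorbed by some variable other than x.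
data Neutral (Γ : Ctx) (k n : ℕ) (f : Term) (T : Ty) : Set where
  is-x   : f ≡ var n → T ≡ tvar k → Neutral Γ k n f T
  headed : ∀ {h U} → h ≢ n → Γ ∋ h ∶ U → T ⊑ U → (Free n f → Absorber k n Γ) → Neutral Γ k n f T

mutual
  occurrence : ∀ {Γ u A k n} → Γ ∋ n ∶ tvar k → Γ ⊢ u ∶ A → Normal u → Free n u →
               Carries k A ⊎ Absorber k n Γ
  occurrence x (ax l) _ fvar = inj₁ (subst (Carries _) (∋-det x l) c-var)
  occurrence x (→i _ d) (nlam nu) (flam x∈u) with occurrence (there x) d nu x∈u
  ... | inj₁ c = inj₁ (c-cod c)
  ... | inj₂ a with Absorber-pop a
  ...   | inj₁ b  = inj₁ (c-dom b)
  ...   | inj₂ a′ = inj₂ a′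
  occurrence x d@(→e _ _) nu@(napp _ _ _) x∈u with neutral x d nu (λ ())
  ... | is-x () _
  ... | headed _ _ _ absorb = inj₂ (absorb x∈u)
  occurrence x (∀i d _) nu x∈u with occurrence (∋-map {f = weaken} x) d nu x∈u
  ... | inj₁ c = inj₁ (c-all c)
  ... | inj₂ a = inj₂ (Absorber-unweaken a)
  occurrence x (∀e C _ d) nu x∈u with occurrence x d nu x∈u
  ... | inj₁ c = inj₁ (Carries-inst C c)
  ... | inj₂ a = inj₂ a

  neutral : ∀ {Γ f T k n} → Γ ∋ n ∶ tvar k → Γ ⊢ f ∶ T → Normal f → ¬ IsLam f → Neutral Γ k n f T
  neutral {n = n} x (ax {x = h} l) _ _ with h ≟ n
  ... | yes refl = is-x refl (sym (∋-det x l))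
  ... | no ne    = headed ne l ⊑-refl (λ { fvar → ⊥-elim (ne refl) })
  neutral x (→i _ _) _ not-lam = ⊥-elim (not-lam tt)
  neutral x (→e d e) (napp nl nf na) _ with neutral x d nf nl
  ... | is-x _ ()
  ... | headed ne l r absorb = headed ne l (⊑-app r) λ where
    (fapˡ x∈f) → absorb x∈f
    (fapʳ x∈a) → absorb-argument ne l r (occurrence x e na x∈a)
  neutral x (∀i d X-free) nf not-lam with neutral (∋-map {f = weaken} x) d nf not-lam
  neutral x (∀i d ()) nf not-lam | is-x _ refl
  ... | headed ne l r absorb with ∋-map⁻ l
  ...   | U , l′ , refl = headed ne l′ (⊑-gen r) (λ x∈f → Absorber-unweaken (absorb x∈f))
  neutral x (∀e {A = A} C _ d) nf not-lam with neutral x d nf not-lam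
  ... | is-x _ ()
  ... | headed ne l r absorb = headed ne l (⊑-inst A C r) absorb

-- The weakened type carries X₀ only if the original one does (instantiate X₀ by X₀).
Carries-unweaken : ∀ {A} → Carries 0 (weaken A) → Carries 0 A
Carries-unweaken {A} c =
  subst (Carries 0) (inst-weaken (tvar 0) A) (Carries-sub (single (tvar 0)) refl c)

no-other-absorber : ∀ {k} → ¬ Absorber k 0 (tvar 0 ∷ [])
no-other-absorber (absorber ne here      _) = ne refl
no-other-absorber (absorber ne (there ()) _)

theorem2p1p7 : (S : Ty) → Good S → Closed S → Pos S → OutputType S
theorem2p1p7 S _ closed pos = closed , λ t normal ⊢λt x∈t →
  case occurrence here (lam-inversion ⊢λt) normal x∈t of λ where
    (inj₁ carries) → pos-not-carries pos (closed 0) (Carries-unweaken carries)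
    (inj₂ other)   → no-other-absorber other
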